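{- Let $K_6$ be the complete graph on the vertex set $\mathcal{V}=\{A,B,C,D,E,F\}$. Let $\mathcal{B}$ be the set of the $10$ bisections of $K_6$, i.e. the unordered partitions of $\mathcal{V}$ into two $3$-element subsets (two disjoint triangles). For an edge $uv$ of $K_6$, let $e(u,v)\subseteq\mathcal{B}$ be the set of bisections in which $u$ and $v$ lie in the same triangle; $|e(u,v)|=4$. Let $\mathcal{F}$ be the set of the six $1$-factorizations of $K_6$ (partitions of the edge set of $K_6$ into five perfect matchings). For a perfect matching $m$ of $K_6$, let $\underline{m}\subseteq\mathcal{B}$ be the set of bisections not belonging to $e(u,v)$ for any edge $uv$ of $m$ (so $|\underline{m}|=4$). Any two distinct $1$-factorizations $f,g\in\mathcal{F}$ have exactly one perfect matching in common, denoted $m(f,g)$. Define three families of $6$-element subsets of the $22$-element set $\mathcal{V}\cup\mathcal{B}\cup\mathcal{F}$: (i) $\widetilde{\mathcal{E}}=\{\{u,v\}\cup e(u,v) : u,v\in\mathcal{V},\ u\neq v\}\cup\{\mathcal{V}\}$; (ii) $\widetilde{\mathcal{M}}=\{\{f,g\}\cup \underline{m(f,g)} : f,g\in\mathcal{F},\ f\neq g\}\cup\{\mathcal{F}\}$; (iii) $\mathcal{EM}$: for each pair $(e,m)$ where $e=vv'$ is an edge of $K_6$ and $m$ is a perfect matching of $K_6$ containing $e$, with $f,f'\in\mathcal{F}$ the two $1$-factorizations whose common matching is $m$, the block $\{v,v',f,f'\}\cup\big(\mathcal{B}\setminus(e(v,v')\cup\underline{m})\big)$. Then $(\mathcal{V}\cup\mathcal{B}\cup\mathcal{F},\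 \widetilde{\mathcal{E}}\cup\widetilde{\mathcal{M}}\cup\mathcal{EM})$ is a $3$-$(22,6,1)$ design, i.e. every $3$-element subset of the $22$ points is contained in exactly one of these blocks.
   Context: A $t$-$(v,k,\lambda)$ design is a pair $(\mathbb{V},\mathbb{B})$ where $\mathbb{V}$ is a set of $v$ points and $\mathbb{B}$ is a collection of $k$-element subsets of $\mathbb{V}$ (blocks) such that every $t$-element subset of $\mathbb{V}$ is contained in exactly $\lambda$ blocks. A perfect matching of $K_6$ is a set of three pairwise disjoint edges; $K_6$ has $15$ perfect matchings, each contained in exactly two of its six $1$-factorizations. -}

module Defs where

open import Data.Bool using (Bool; true; false)
open import Data.Nat using (ℕ)
open import Data.Fin using (Fin)
open import Data.Fin.Subset using (Subset; ∣_∣)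
open import Data.Vec using (Vec; lookup)
open import Data.Vec.Relation.Unary.All using (All)
open import Data.Vec.Membership.Propositional using (_∈_)
open import Data.Product using (Σ; ∃; _×_; _,_)
open import Data.Sum using (_⊎_)
open import Data.Empty using (⊥)
open import Data.Unit using (⊤)
open import Relation.Binary.PropositionalEquality using (_≡_; _≢_)
open import Relation.Nullary using (¬_)
open import Function.Bundles using (_⇔_)

Vtx : Set
Vtx = Fin 6

Rel6 : Set
Rel6 = Vec (Subset 6) 6

rel : Rel6 → Vtx → Vtx → Set
rel R u v = lookup (lookup R u) v ≡ true

-- Bisections: an unordered partition of 𝒱 into two 3-element subsets,
-- encoded canonically by its "same part" equivalence relation R
-- (R u v iff u and v lie in the same triangle).  An equivalence
-- relation on 6 points all of whose classes have size 3 is exactly a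
-- partition into two 3-sets.

record IsBisection (R : Rel6) : Set where
  field
    reflB  : ∀ u → rel R u u
    symB   : ∀ u v → rel R u v → rel R v u
    transB : ∀ u v w → rel R u v → rel R v w → rel R u w
    class3 : ∀ u → ∣ lookup R u ∣ ≡ 3

InE : Vtx → Vtx → Rel6 → Set
InE u v R = rel R u v

record IsPerfectMatching (M : Rel6) : Set where
  field
    irreflM : ∀ u → ¬ rel M u u
    symM    : ∀ u v → rel M u v → rel M v u
    degree1 : ∀ u → ∣ lookup M u ∣ ≡ 1

InUnder : Rel6 → Rel6 → Set
InUnder M R = ∀ u v → rel M u v → ¬ rel R u v

-- As a 1-factorization is a SET of
-- matchings, two such vectors denote the same factorization iff they
-- contain the same matchings (_≈F_ below).

Fact : Set
Fact = Vec Rel6 5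

record IsFactorization (ms : Fact) : Set where
  field
    allPM   : All IsPerfectMatching ms
    covers  : ∀ u v → u ≢ v → Σ (Fin 5) (λ i → rel (lookup ms i) u v)
    unique  : ∀ u v → u ≢ v → ∀ i j →
              rel (lookup ms i) u v → rel (lookup ms j) u v → i ≡ j

_≈F_ : Fact → Fact → Set
f ≈F g = ∀ (M : Rel6) → (M ∈ f) ⇔ (M ∈ g)

data Point : Set where
  pV : Vtx → Point
  pB : Rel6 → Point
  pF : Fact → Point

ValidPoint : Point → Set
ValidPoint (pV _) = ⊤
ValidPoint (pB R) = IsBisection R
ValidPoint (pF f) = IsFactorization f

_≈P_ : Point → Point → Set
pV u ≈P pV v = u ≡ v
pB R ≈P pB S = R ≡ S
pF f ≈P pF g = f ≈F g
_    ≈P _    = ⊥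

-- Blocks.  Each block is a set of points (a predicate on Point); the
-- family of blocks is indexed by the data generating it.

data BlockIx : Set where
  edgeB : (u v : Vtx) → u ≢ v → BlockIx
  allV  : BlockIx
  matchB : (f g : Fact) → IsFactorization f → IsFactorization g →
           ¬ (f ≈F g) → (M : Rel6) → M ∈ f → M ∈ g → BlockIx
  allF  : BlockIx
  emB   : (v v' : Vtx) → v ≢ v' → (M : Rel6) → IsPerfectMatching M →
          rel M v v' → (f f' : Fact) → IsFactorization f →
          IsFactorization f' → ¬ (f ≈F f') → M ∈ f → M ∈ f' → BlockIx

InBlock : BlockIx → Point → Set
InBlock (edgeB u v _) (pV x) = (x ≡ u) ⊎ (x ≡ v)
InBlock (edgeB u v _) (pB R) = InE u v R
InBlock (edgeB u v _) (pF _) = ⊥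
InBlock allV (pV _) = ⊤
InBlock allV (pB _) = ⊥
InBlock allV (pF _) = ⊥
InBlock (matchB f g _ _ _ M _ _) (pV _) = ⊥
InBlock (matchB f g _ _ _ M _ _) (pB R) = InUnder M R
InBlock (matchB f g _ _ _ M _ _) (pF h) = (h ≈F f) ⊎ (h ≈F g)
InBlock allF (pV _) = ⊥
InBlock allF (pB _) = ⊥
InBlock allF (pF _) = ⊤
InBlock (emB v v' _ M _ _ f f' _ _ _ _ _) (pV x) = (x ≡ v) ⊎ (x ≡ v')
InBlock (emB v v' _ M _ _ f f' _ _ _ _ _) (pB R) =
  ¬ InE v v' R × ¬ InUnder M R
InBlock (emB v v' _ M _ _ f f' _ _ _ _ _) (pF h) = (h ≈F f) ⊎ (h ≈F f')

SameBlock : BlockIx → BlockIx → Set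
SameBlock i j = ∀ p → ValidPoint p → (InBlock i p ⇔ InBlock j p)

Is3Design1 : Set
Is3Design1 =
  ∀ p q r → ValidPoint p → ValidPoint q → ValidPoint r →
  ¬ (p ≈P q) → ¬ (p ≈P r) → ¬ (q ≈P r) →
  (∃ λ i → InBlock i p × InBlock i q × InBlock i r)
  × (∀ i j → InBlock i p → InBlock i q → InBlock i r →
             InBlock j p → InBlock j q → InBlock j r → SameBlock i j)

-- Every point is equal to one of 22 canonical points: a vertex; one of the ten bisections, each of which
-- is determined by its triangle through the vertex A = 0; or one of the six 1-factorizations, each of which
-- is determined by its five pairwise edge-disjoint perfect matchings.  Every block has the same points as a
-- block described by a small code (an edge, a perfect matching, or an edge together with a matching through
-- it), since a perfect matching lies in exactly two 1-factorizations.  On the canonical points the valid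
-- codes give 77 six-element blocks; evaluation shows that two of them share at most two points, which gives
-- uniqueness, and that every three points lie in one of them, which gives existence.

module Submission where

open import Defs
open import Data.Bool using (true; false; if_then_else_)
import Data.Bool.Properties as Boolₚ
open import Data.Empty using (⊥)
open import Data.Fin using (Fin; zero; suc; #_; _<_; _<?_; splitAt; join)
open import Data.Fin.Properties using (all?; any?; _≟_; <-cmp; splitAt-join)
open import Data.Fin.Subset using (Subset; inside; outside; ⁅_⁆; ∁; _∪_; _∩_; ∣_∣; _∈_; _⊆_) renaming (⊥ to ∅)
open import Data.Fin.Subset.Properties
  using ( x∈p⇒∣p-x∣<∣p∣; x∈p∧x≢y⇒x∈p-y; drop-∷-⊆; p⊆q⇒∣p∣≤∣q∣; anySubset?; x∈⁅x⁆; x∈⁅y⁆⇔x≡y; ∣⁅x⁆∣≡1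
        ; ⊆-antisym; x∉p⇒x∈∁p; ∣∁p∣≡n∸∣p∣; _∈?_; x∈p∩q⁺)
open import Data.List as List using (List; []; _∷_; [_])
import Data.List.Relation.Unary.All as ListAll
import Data.List.Relation.Unary.Any as ListAny
open import Data.List.Membership.Propositional using (find) renaming (_∈_ to _∈ₗ_)
open import Data.List.Membership.Propositional.Properties using (∈-map⁺; ∈-map⁻; ∈-filter⁺; ∈-allFin; ∈-concat⁺′)
import Data.List.Membership.DecPropositional as ListDecMembership
open import Data.Nat using (ℕ; zero; suc; _≤_; _≤?_; _∸_; z≤n; s≤s)
import Data.Nat.Properties as ℕₚ
open import Data.Product as Product using (Σ; ∃; ∃₂; _×_; _,_; proj₁; proj₂; uncurry)
open import Data.Sum using (_⊎_; inj₁; inj₂; map₂; [_,_]′)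
open import Data.Unit using (⊤; tt)
open import Data.Vec using (Vec; []; _∷_; here; lookup; map; tabulate)
open import Data.Vec.Properties
  using (lookup∘tabulate; tabulate∘lookup; tabulate-cong; tabulate-∘; []=⇒lookup; lookup⇒[]=)
import Data.Vec.Properties as Vecₚ
open import Data.Vec.Relation.Unary.All as All using (All)
import Data.Vec.Relation.Unary.All.Properties as Allₚ
open import Data.Vec.Relation.Unary.AllPairs using (AllPairs; []; _∷_)
open import Data.Vec.Relation.Unary.AllPairs.Properties using (tabulate⁺)
import Data.Vec.Relation.Unary.Any as Any
import Data.Vec.Relation.Unary.Any.Properties as Anyₚ
open import Data.Vec.Membership.Propositional using () renaming (_∈_ to _∈ᵥ_)
open import Data.Vec.Membership.Propositional.Properties using (fromAny) renaming (∈-map⁺ to ∈ᵥ-map⁺)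
import Data.Vec.Membership.DecPropositional as VecDecMembership
open import Function using (_∘_)
open import Function.Bundles using (_⇔_; mk⇔; Equivalence)
open import Function.Properties.Equivalence using () renaming (refl to ⇔-refl)
open import Relation.Binary.Definitions using (tri<; tri≈; tri>)
open import Relation.Binary.PropositionalEquality using (_≡_; _≢_; refl; sym; trans; cong; subst)
open import Relation.Nullary using (Dec; yes; no; does; ¬_; contradiction)
open import Relation.Nullary.Decidable
  using (toWitness; map′; dec-true; decidable-stable; _×-dec_; _⊎-dec_; _→-dec_; ¬?)

open Equivalence using (to; from)

private
  _∈ᵥ?_ = VecDecMembership._∈?_ (_≟_ {n = 15})
  _≟ₛ_ = Vecₚ.≡-dec {n = 6} Boolₚ._≟_

private
  variable
    n : ℕ
    p q : Subset n
    x y z : Fin n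

∣p∣≡0⇒p≡∅ : ∀ (p : Subset n) → ∣ p ∣ ≡ 0 → p ≡ ∅
∣p∣≡0⇒p≡∅ []            _   = refl
∣p∣≡0⇒p≡∅ (outside ∷ p) |p| = cong (outside ∷_) (∣p∣≡0⇒p≡∅ p |p|)

∣p∣≡1⇒p≡⁅x⁆ : ∀ (p : Subset n) → ∣ p ∣ ≡ 1 → ∃ λ x → p ≡ ⁅ x ⁆
∣p∣≡1⇒p≡⁅x⁆ (inside ∷ p)  |p| = zero , cong (inside ∷_) (∣p∣≡0⇒p≡∅ p (ℕₚ.suc-injective |p|))
∣p∣≡1⇒p≡⁅x⁆ (outside ∷ p) |p| = Product.map suc (cong (outside ∷_)) (∣p∣≡1⇒p≡⁅x⁆ p |p|)

p⊆q∧∣q∣≤∣p∣⇒p≡q : ∀ (p q : Subset n) → p ⊆ q → ∣ q ∣ ≤ ∣ p ∣ → p ≡ q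
p⊆q∧∣q∣≤∣p∣⇒p≡q []            []            _   _   = refl
p⊆q∧∣q∣≤∣p∣⇒p≡q (outside ∷ p) (outside ∷ q) p⊆q |q| =
  cong (outside ∷_) (p⊆q∧∣q∣≤∣p∣⇒p≡q p q (drop-∷-⊆ p⊆q) |q|)
p⊆q∧∣q∣≤∣p∣⇒p≡q (inside ∷ p)  (inside ∷ q)  p⊆q |q| =
  cong (inside ∷_) (p⊆q∧∣q∣≤∣p∣⇒p≡q p q (drop-∷-⊆ p⊆q) (ℕₚ.≤-pred |q|))
p⊆q∧∣q∣≤∣p∣⇒p≡q (inside ∷ p)  (outside ∷ q) p⊆q _   with () ← p⊆q here
p⊆q∧∣q∣≤∣p∣⇒p≡q (outside ∷ p) (inside ∷ q)  p⊆q |q| =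
  contradiction (ℕₚ.≤-trans |q| (p⊆q⇒∣p∣≤∣q∣ (drop-∷-⊆ p⊆q))) (ℕₚ.<-irrefl refl)

three-elements⇒3≤∣p∣ : x ∈ p → y ∈ p → z ∈ p → x ≢ y → x ≢ z → y ≢ z → 3 ≤ ∣ p ∣
three-elements⇒3≤∣p∣ x∈p y∈p z∈p x≢y x≢z y≢z =
  ℕₚ.≤-trans (s≤s (ℕₚ.≤-trans (s≤s (ℕₚ.≤-trans (s≤s z≤n) (x∈p⇒∣p-x∣<∣p∣ z∈p-x-y))) (x∈p⇒∣p-x∣<∣p∣ y∈p-x)))
             (x∈p⇒∣p-x∣<∣p∣ x∈p)
  where
  y∈p-x = x∈p∧x≢y⇒x∈p-y y∈p (x≢y ∘ sym)
  z∈p-x-y = x∈p∧x≢y⇒x∈p-y (x∈p∧x≢y⇒x∈p-y z∈p (x≢z ∘ sym)) (y≢z ∘ sym)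

∈-tabulate-does : ∀ {P : Fin n → Set} (P? : ∀ x → Dec (P x)) x → x ∈ tabulate (does ∘ P?) ⇔ P x
∈-tabulate-does P? x = mk⇔
  (λ x∈ → does≡true⇒ (P? x) (trans (sym (lookup∘tabulate (does ∘ P?) x)) ([]=⇒lookup x∈)))
  (λ Px → lookup⇒[]= x _ (trans (lookup∘tabulate (does ∘ P?) x) (dec-true (P? x) Px)))
  where
  does≡true⇒ : ∀ {A : Set} (a? : Dec A) → does a? ≡ true → A
  does≡true⇒ (yes a) _ = a

allSubsets? : ∀ {P : Subset n → Set} → (∀ p → Dec (P p)) → Dec (∀ p → P p)
allSubsets? P? with anySubset? (¬? ∘ P?)
... | yes (p , ¬Pp) = no λ ∀P → ¬Pp (∀P p)
... | no ∄¬P        = yes λ p → decidable-stable (P? p) λ ¬Pp → ∄¬P (p , ¬Pp)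

allVectors? : ∀ {m} {P : Vec (Fin m) n → Set} → (∀ v → Dec (P v)) → Dec (∀ v → P v)
allVectors? {n = zero}  P? = map′ (λ p → λ { [] → p }) (λ h → h []) (P? [])
allVectors? {n = suc n} P? =
  map′ (λ h → λ { (x ∷ v) → h x v }) (λ h x v → h (x ∷ v)) (all? λ x → allVectors? (P? ∘ (x ∷_)))

cliques : ∀ {R : Fin n → Fin n → Set} → (∀ x y → Dec (R x y)) → (k : ℕ) → List (Vec (Fin n) k)
cliques         R? zero    = [ [] ]
cliques {n = n} R? (suc k) =
  List.concatMap (λ xs → List.map (_∷ xs) (List.filter (λ x → All.all? (R? x) xs) (List.allFin n))) (cliques R? k)

allPairs⇒∈cliques : ∀ {R : Fin n → Fin n → Set} (R? : ∀ x y → Dec (R x y)) {k} {xs : Vec (Fin n) k} →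
                    AllPairs R xs → xs ∈ₗ cliques R? k
allPairs⇒∈cliques R? []                     = ListAny.here refl
allPairs⇒∈cliques R? (_∷_ {x = x} x~xs xs~) =
  ∈-concat⁺′ (∈-map⁺ (_∷ _) (∈-filter⁺ (λ x → All.all? (R? x) _) (∈-allFin x) x~xs))
             (∈-map⁺ _ (allPairs⇒∈cliques R? xs~))

module _ {P : Fin n → Fin n → Fin n → Set}
         (swap₁₂ : ∀ {a b c} → P a b c → P b a c) (swap₂₃ : ∀ {a b c} → P a b c → P a c b)
         (increasing : ∀ a b c → a < b → b < c → P a b c) where

  private
    fromLess : ∀ a b c → a < b → a ≢ c → b ≢ c → P a b c
    fromLess a b c a<b a≢c b≢c with <-cmp b c | <-cmp a c
    ... | tri< b<c _ _ | _            = increasing a b c a<b b<c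
    ... | tri≈ _ b≡c _ | _            = contradiction b≡c b≢c
    ... | tri> _ _ c<b | tri< a<c _ _ = swap₂₃ (increasing a c b a<c c<b)
    ... | tri> _ _ c<b | tri≈ _ a≡c _ = contradiction a≡c a≢c
    ... | tri> _ _ c<b | tri> _ _ c<a = swap₂₃ (swap₁₂ (increasing c a b c<a a<b))

  increasing⇒distinct : ∀ a b c → a ≢ b → a ≢ c → b ≢ c → P a b c
  increasing⇒distinct a b c a≢b a≢c b≢c with <-cmp a b
  ... | tri< a<b _ _ = fromLess a b c a<b a≢c b≢c
  ... | tri≈ _ a≡b _ = contradiction a≡b a≢b
  ... | tri> _ _ b<a = swap₁₂ (fromLess b a c b<a b≢c a≢c)

rel? : ∀ R u v → Dec (rel R u v)
rel? R u v = lookup (lookup R u) v Boolₚ.≟ true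

∈⇔rel : ∀ R u v → v ∈ lookup R u ⇔ rel R u v
∈⇔rel R u v = mk⇔ []=⇒lookup (lookup⇒[]= v (lookup R u))

-- Perfect matchings

FixedPointFreeInvolution : (Vtx → Vtx) → Set
FixedPointFreeInvolution σ = ∀ u → σ u ≢ u × σ (σ u) ≡ u

fixedPointFreeInvolution? : ∀ σ → Dec (FixedPointFreeInvolution σ)
fixedPointFreeInvolution? σ = all? λ u → ¬? (σ u ≟ u) ×-dec (σ (σ u) ≟ u)

fixedPointFreeInvolution-cong : ∀ {σ τ} → (∀ u → σ u ≡ τ u) → FixedPointFreeInvolution σ → FixedPointFreeInvolution τ
fixedPointFreeInvolution-cong {σ} {τ} σ≗τ inv u =
  (λ τu≡u → proj₁ (inv u) (trans (σ≗τ u) τu≡u)) ,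
  trans (sym (σ≗τ (τ u))) (trans (cong σ (sym (σ≗τ u))) (proj₂ (inv u)))

perfectMatching : (Vtx → Vtx) → Rel6
perfectMatching σ = tabulate (⁅_⁆ ∘ σ)

perfectMatching-cong : ∀ {σ τ} → (∀ u → σ u ≡ τ u) → perfectMatching σ ≡ perfectMatching τ
perfectMatching-cong σ≗τ = tabulate-cong (cong ⁅_⁆ ∘ σ≗τ)

rel-perfectMatching : ∀ σ u v → rel (perfectMatching σ) u v ⇔ v ≡ σ u
rel-perfectMatching σ u v = mk⇔
  (λ r → to x∈⁅y⁆⇔x≡y (subst (v ∈_) (lookup∘tabulate (⁅_⁆ ∘ σ) u) (from (∈⇔rel (perfectMatching σ) u v) r)))
  (λ { refl → to (∈⇔rel (perfectMatching σ) u v) (subst (σ u ∈_) (sym (lookup∘tabulate (⁅_⁆ ∘ σ) u)) (x∈⁅x⁆ (σ u))) })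

fixedPointFreeInvolution⇒isPerfectMatching : ∀ {σ} → FixedPointFreeInvolution σ →
                                             IsPerfectMatching (perfectMatching σ)
fixedPointFreeInvolution⇒isPerfectMatching {σ} inv = record
  { irreflM = λ u r → proj₁ (inv u) (sym (to (rel-perfectMatching σ u u) r))
  ; symM    = λ u v r → from (rel-perfectMatching σ v u)
                (trans (sym (proj₂ (inv u))) (cong σ (sym (to (rel-perfectMatching σ u v) r))))
  ; degree1 = λ u → trans (cong ∣_∣ (lookup∘tabulate (⁅_⁆ ∘ σ) u)) (∣⁅x⁆∣≡1 (σ u))
  }

partners : Vec (Vec Vtx 6) 15
partners =
  (# 1 ∷ # 0 ∷ # 3 ∷ # 2 ∷ # 5 ∷ # 4 ∷ []) ∷
  (# 1 ∷ # 0 ∷ # 4 ∷ # 5 ∷ # 2 ∷ # 3 ∷ []) ∷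
  (# 1 ∷ # 0 ∷ # 5 ∷ # 4 ∷ # 3 ∷ # 2 ∷ []) ∷
  (# 2 ∷ # 3 ∷ # 0 ∷ # 1 ∷ # 5 ∷ # 4 ∷ []) ∷
  (# 2 ∷ # 4 ∷ # 0 ∷ # 5 ∷ # 1 ∷ # 3 ∷ []) ∷
  (# 2 ∷ # 5 ∷ # 0 ∷ # 4 ∷ # 3 ∷ # 1 ∷ []) ∷
  (# 3 ∷ # 2 ∷ # 1 ∷ # 0 ∷ # 5 ∷ # 4 ∷ []) ∷
  (# 3 ∷ # 4 ∷ # 5 ∷ # 0 ∷ # 1 ∷ # 2 ∷ []) ∷
  (# 3 ∷ # 5 ∷ # 4 ∷ # 0 ∷ # 2 ∷ # 1 ∷ []) ∷
  (# 4 ∷ # 2 ∷ # 1 ∷ # 5 ∷ # 0 ∷ # 3 ∷ []) ∷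
  (# 4 ∷ # 3 ∷ # 5 ∷ # 1 ∷ # 0 ∷ # 2 ∷ []) ∷
  (# 4 ∷ # 5 ∷ # 3 ∷ # 2 ∷ # 0 ∷ # 1 ∷ []) ∷
  (# 5 ∷ # 2 ∷ # 1 ∷ # 4 ∷ # 3 ∷ # 0 ∷ []) ∷
  (# 5 ∷ # 3 ∷ # 4 ∷ # 1 ∷ # 2 ∷ # 0 ∷ []) ∷
  (# 5 ∷ # 4 ∷ # 3 ∷ # 2 ∷ # 1 ∷ # 0 ∷ []) ∷ []

matching : Fin 15 → Rel6
matching x = perfectMatching (lookup (lookup partners x))

-- Each abstract block is a finite check decided by evaluation; abstract keeps Agda from unfolding the
-- decision wherever the result is used.
abstract
  partners-involutive : ∀ x → FixedPointFreeInvolution (lookup (lookup partners x))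
  partners-involutive = toWitness {a? = all? λ x → fixedPointFreeInvolution? (lookup (lookup partners x))} _

  matching-injective : ∀ {x y} → matching x ≡ matching y → x ≡ y
  matching-injective {x} {y} = toWitness
    {a? = all? λ x → all? λ y → Vecₚ.≡-dec _≟ₛ_ (matching x) (matching y) →-dec x ≟ y} _ x y

  involutions-listed : ∀ σ → FixedPointFreeInvolution (lookup σ) → σ ∈ᵥ partners
  involutions-listed = toWitness
    {a? = allVectors? λ σ → fixedPointFreeInvolution? (lookup σ) →-dec
          VecDecMembership._∈?_ (Vecₚ.≡-dec _≟_) σ partners} _

matching-isPerfectMatching : ∀ x → IsPerfectMatching (matching x)
matching-isPerfectMatching x = fixedPointFreeInvolution⇒isPerfectMatching (partners-involutive x)

module _ {M : Rel6} (pm : IsPerfectMatching M) where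
  open IsPerfectMatching pm

  private
    row-singleton : ∀ u → ∃ λ v → lookup M u ≡ ⁅ v ⁆
    row-singleton u = ∣p∣≡1⇒p≡⁅x⁆ (lookup M u) (degree1 u)

  partner : Vtx → Vtx
  partner = proj₁ ∘ row-singleton

  ≡perfectMatching-partner : M ≡ perfectMatching partner
  ≡perfectMatching-partner = trans (sym (tabulate∘lookup M)) (tabulate-cong (proj₂ ∘ row-singleton))

  private
    rel⇔≡partner : ∀ u v → rel M u v ⇔ v ≡ partner u
    rel⇔≡partner u v = subst (λ N → rel N u v ⇔ v ≡ partner u) (sym ≡perfectMatching-partner)
                             (rel-perfectMatching partner u v)

  partner-involutive : FixedPointFreeInvolution partner
  partner-involutive u =
    (λ pu≡u → irreflM u (subst (rel M u) pu≡u (from (rel⇔≡partner u (partner u)) refl))) ,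
    sym (to (rel⇔≡partner (partner u) u) (symM u (partner u) (from (rel⇔≡partner u (partner u)) refl)))

perfectMatching-classified : ∀ {M} → IsPerfectMatching M → ∃ λ x → M ≡ matching x
perfectMatching-classified pm = Any.index σ∈ , trans (≡perfectMatching-partner pm) (perfectMatching-cong partner≗)
  where
  σ∈ : tabulate (partner pm) ∈ᵥ partners
  σ∈ = involutions-listed _
         (fixedPointFreeInvolution-cong (λ u → sym (lookup∘tabulate (partner pm) u)) (partner-involutive pm))
  partner≗ : ∀ u → partner pm u ≡ lookup (lookup partners (Any.index σ∈)) u
  partner≗ u = trans (sym (lookup∘tabulate (partner pm) u)) (cong (λ τ → lookup τ u) (Anyₚ.lookup-index σ∈))

-- One-factorizations

-- Two perfect matchings share an edge exactly when their partner functions agree at some vertex.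
Disjoint : Fin 15 → Fin 15 → Set
Disjoint x y = ∀ u → lookup (lookup partners x) u ≢ lookup (lookup partners y) u

disjoint? : ∀ x y → Dec (Disjoint x y)
disjoint? x y = all? λ u → ¬? (lookup (lookup partners x) u ≟ lookup (lookup partners y) u)

factorizationIndices : Vec (Vec (Fin 15) 5) 6
factorizationIndices =
  (# 0 ∷ # 4 ∷ # 8 ∷ # 10 ∷ # 12 ∷ []) ∷
  (# 0 ∷ # 5 ∷ # 7 ∷ # 9 ∷ # 13 ∷ []) ∷
  (# 1 ∷ # 3 ∷ # 7 ∷ # 11 ∷ # 12 ∷ []) ∷
  (# 1 ∷ # 5 ∷ # 6 ∷ # 10 ∷ # 14 ∷ []) ∷
  (# 2 ∷ # 3 ∷ # 8 ∷ # 9 ∷ # 14 ∷ []) ∷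
  (# 2 ∷ # 4 ∷ # 6 ∷ # 11 ∷ # 13 ∷ []) ∷ []

_∈ᶠ_ : Fin 15 → Fin 6 → Set
x ∈ᶠ a = x ∈ᵥ lookup factorizationIndices a

_∈ᶠ?_ : ∀ x a → Dec (x ∈ᶠ a)
x ∈ᶠ? a = VecDecMembership._∈?_ _≟_ x (lookup factorizationIndices a)

factorization : Fin 6 → Fact
factorization a = map matching (lookup factorizationIndices a)

SameElements : ∀ {n} → Vec (Fin 15) n → Vec (Fin 15) n → Set
SameElements xs ys = All (_∈ᵥ ys) xs × All (_∈ᵥ xs) ys

sameElements? : ∀ {n} (xs ys : Vec (Fin 15) n) → Dec (SameElements xs ys)
sameElements? xs ys = All.all? (_∈ᵥ? ys) xs ×-dec All.all? (_∈ᵥ? xs) ys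

abstract
  disjointMatchings-formFactorization : ∀ {xs} → AllPairs Disjoint xs →
                                        ∃ λ a → SameElements xs (lookup factorizationIndices a)
  disjointMatchings-formFactorization {xs} disjoint =
    ListAll.lookup listed (allPairs⇒∈cliques {R = Disjoint} disjoint? {k = 5} {xs = xs} disjoint)
    where
    listed : ListAll.All (λ xs → ∃ λ a → SameElements xs (lookup factorizationIndices a)) (cliques disjoint? 5)
    listed = toWitness
      {a? = ListAll.all? (λ xs → any? λ a → sameElements? xs (lookup factorizationIndices a)) (cliques disjoint? 5)} _

  factorization-covers : ∀ a u v → u ≢ v → Σ (Fin 5) λ i → rel (lookup (factorization a) i) u v
  factorization-covers = toWitness
    {a? = all? λ a → all? λ u → all? λ v → ¬? (u ≟ v) →-dec any? λ i → rel? (lookup (factorization a) i) u v} _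

  factorization-unique : ∀ a u v → u ≢ v → ∀ i j →
                         rel (lookup (factorization a) i) u v → rel (lookup (factorization a) j) u v → i ≡ j
  factorization-unique = toWitness
    {a? = all? λ a → all? λ u → all? λ v → ¬? (u ≟ v) →-dec all? λ i → all? λ j →
          rel? (lookup (factorization a) i) u v →-dec rel? (lookup (factorization a) j) u v →-dec i ≟ j} _

  matching-inTwoFactorizations : ∀ x → ∃₂ λ a b → a ≢ b × x ∈ᶠ a × x ∈ᶠ b
  matching-inTwoFactorizations = toWitness
    {a? = all? λ x → any? λ a → any? λ b → ¬? (a ≟ b) ×-dec x ∈ᶠ? a ×-dec x ∈ᶠ? b} _

  matching-inAtMostTwoFactorizations : ∀ x a b c → a ≢ b →
    x ∈ᶠ a → x ∈ᶠ b → x ∈ᶠ c → c ≡ a ⊎ c ≡ b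
  matching-inAtMostTwoFactorizations = toWitness
    {a? = all? λ x → all? λ a → all? λ b → all? λ c → ¬? (a ≟ b) →-dec x ∈ᶠ? a →-dec
          x ∈ᶠ? b →-dec x ∈ᶠ? c →-dec (c ≟ a ⊎-dec c ≟ b)} _

  factorizationIndices-distinct : ∀ a b → a ≢ b → ∃ λ x → x ∈ᶠ a × ¬ x ∈ᶠ b
  factorizationIndices-distinct = toWitness
    {a? = all? λ a → all? λ b → ¬? (a ≟ b) →-dec any? λ x → x ∈ᶠ? a ×-dec ¬? (x ∈ᶠ? b)} _

≈F-sym : ∀ {f g} → f ≈F g → g ≈F f
≈F-sym f≈g M = mk⇔ (from (f≈g M)) (to (f≈g M))

≈F-trans : ∀ {f g h} → f ≈F g → g ≈F h → f ≈F h
≈F-trans f≈g g≈h M = mk⇔ (to (g≈h M) ∘ to (f≈g M)) (from (f≈g M) ∘ from (g≈h M))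

map-matching-≈F : ∀ {xs ys} → SameElements xs ys → map matching xs ≈F map matching ys
map-matching-≈F (xs⊆ys , ys⊆xs) M = mk⇔ (transfer xs⊆ys) (transfer ys⊆xs)
  where
  transfer : ∀ {xs ys : Vec (Fin 15) 5} → All (_∈ᵥ ys) xs → M ∈ᵥ map matching xs → M ∈ᵥ map matching ys
  transfer xs⊆ys M∈ with fromAny (Anyₚ.map⁻ M∈)
  ... | x , x∈xs , refl = ∈ᵥ-map⁺ matching (All.lookup xs⊆ys x∈xs)

matching∈factorization⇔ : ∀ x a → matching x ∈ᵥ factorization a ⇔ x ∈ᶠ a
matching∈factorization⇔ x a = mk⇔ ∈map⇒ (∈ᵥ-map⁺ matching)
  where
  ∈map⇒ : matching x ∈ᵥ factorization a → x ∈ᶠ a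
  ∈map⇒ M∈ = let y , y∈ , x≡y = fromAny (Anyₚ.map⁻ M∈) in subst (_∈ᶠ a) (sym (matching-injective x≡y)) y∈

factorization-isFactorization : ∀ a → IsFactorization (factorization a)
factorization-isFactorization a = record
  { allPM  = Allₚ.map⁺ (All.universal matching-isPerfectMatching _)
  ; covers = factorization-covers a
  ; unique = factorization-unique a
  }

factorizations-distinct : ∀ {a b} → a ≢ b → ¬ (factorization a ≈F factorization b)
factorizations-distinct {a} {b} a≢b fa≈fb with factorizationIndices-distinct a b a≢b
... | x , x∈a , x∉b =
  x∉b (to (matching∈factorization⇔ x b) (to (fa≈fb (matching x)) (from (matching∈factorization⇔ x a) x∈a)))

module _ {f : Fact} (fac : IsFactorization f) where
  open IsFactorization fac

  private
    classified : ∀ i → ∃ λ x → lookup f i ≡ matching x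
    classified i = perfectMatching-classified (Allₚ.lookup⁺ allPM i)

  matchingIndex : Fin 5 → Fin 15
  matchingIndex = proj₁ ∘ classified

  ≡map-matching : f ≡ map matching (tabulate matchingIndex)
  ≡map-matching =
    trans (sym (tabulate∘lookup f)) (trans (tabulate-cong (proj₂ ∘ classified)) (tabulate-∘ matching matchingIndex))

  matchingIndex-disjoint : ∀ {i j} → i ≢ j → Disjoint (matchingIndex i) (matchingIndex j)
  matchingIndex-disjoint {i} {j} i≢j u σᵢu≡σⱼu =
    i≢j (unique u (σ i u) (proj₁ (partners-involutive (matchingIndex i) u) ∘ sym) i j
                (edge-of i refl) (edge-of j σᵢu≡σⱼu))
    where
    σ : Fin 5 → Vtx → Vtx
    σ k = lookup (lookup partners (matchingIndex k))
    edge-of : ∀ k {v} → v ≡ σ k u → rel (lookup f k) u v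
    edge-of k {v} v≡ = subst (λ N → rel N u v) (sym (proj₂ (classified k))) (from (rel-perfectMatching (σ k) u v) v≡)

factorization-classified : ∀ {f} → IsFactorization f → ∃ λ a → f ≈F factorization a
factorization-classified {f} fac = a , subst (_≈F factorization a) (sym (≡map-matching fac)) (map-matching-≈F same)
  where
  listed : ∃ λ a → SameElements (tabulate (matchingIndex fac)) (lookup factorizationIndices a)
  listed = disjointMatchings-formFactorization (tabulate⁺ {f = matchingIndex fac} (matchingIndex-disjoint fac))
  a = proj₁ listed
  same = proj₂ listed

-- Bisections

bisectionOf : Subset 6 → Rel6
bisectionOf S = tabulate λ u → if lookup S u then S else ∁ S

triangle : Vtx → Vtx → Subset 6
triangle u v = ⁅ zero ⁆ ∪ ⁅ u ⁆ ∪ ⁅ v ⁆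

triangles : Vec (Subset 6) 10
triangles =
  triangle (# 1) (# 2) ∷ triangle (# 1) (# 3) ∷ triangle (# 1) (# 4) ∷ triangle (# 1) (# 5) ∷
  triangle (# 2) (# 3) ∷ triangle (# 2) (# 4) ∷ triangle (# 2) (# 5) ∷
  triangle (# 3) (# 4) ∷ triangle (# 3) (# 5) ∷ triangle (# 4) (# 5) ∷ []

bisection : Fin 10 → Rel6
bisection t = bisectionOf (lookup triangles t)

abstract
  triangles-throughZero : ∀ S → ∣ S ∣ ≡ 3 → zero ∈ S → ∃ λ t → S ≡ lookup triangles t
  triangles-throughZero = toWitness
    {a? = allSubsets? λ S → ∣ S ∣ ℕₚ.≟ 3 →-dec zero ∈? S →-dec any? λ t → S ≟ₛ lookup triangles t} _

module _ {R : Rel6} (bis : IsBisection R) where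
  open IsBisection bis

  private
    row⊆ : ∀ {u v} → rel R u v → lookup R v ⊆ lookup R u
    row⊆ {u} {v} uRv {w} w∈ = from (∈⇔rel R u w) (transB u v w uRv (to (∈⇔rel R v w) w∈))

  rows-equal : ∀ {u v} → rel R u v → lookup R u ≡ lookup R v
  rows-equal uRv = ⊆-antisym (row⊆ (symB _ _ uRv)) (row⊆ uRv)

  rows-complementary : ∀ {u v} → ¬ rel R u v → lookup R v ≡ ∁ (lookup R u)
  rows-complementary {u} {v} ¬uRv = p⊆q∧∣q∣≤∣p∣⇒p≡q (lookup R v) (∁ (lookup R u)) v⊆∁u (ℕₚ.≤-reflexive ∣∁u∣≡∣v∣)
    where
    v⊆∁u : lookup R v ⊆ ∁ (lookup R u)
    v⊆∁u {w} w∈v = x∉p⇒x∈∁p λ w∈u → ¬uRv (transB u w v (to (∈⇔rel R u w) w∈u) (symB v w (to (∈⇔rel R v w) w∈v)))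
    ∣∁u∣≡∣v∣ : ∣ ∁ (lookup R u) ∣ ≡ ∣ lookup R v ∣
    ∣∁u∣≡∣v∣ = trans (∣∁p∣≡n∸∣p∣ (lookup R u)) (trans (cong (6 ∸_) (class3 u)) (sym (class3 v)))

  ≡bisectionOf-row₀ : R ≡ bisectionOf (lookup R zero)
  ≡bisectionOf-row₀ = trans (sym (tabulate∘lookup R)) (tabulate-cong row)
    where
    row : ∀ u → lookup R u ≡ (if lookup (lookup R zero) u then lookup R zero else ∁ (lookup R zero))
    row u with lookup (lookup R zero) u in 0Ru
    ... | true  = sym (rows-equal 0Ru)
    ... | false = rows-complementary λ 0Ru′ → contradiction (trans (sym 0Ru) 0Ru′) λ ()

bisection-classified : ∀ {R} → IsBisection R → ∃ λ t → R ≡ bisection t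
bisection-classified {R} bis with triangles-throughZero (lookup R zero) (IsBisection.class3 bis zero)
                                     (from (∈⇔rel R zero zero) (IsBisection.reflB bis zero))
... | t , row₀≡ = t , trans (≡bisectionOf-row₀ bis) (cong bisectionOf row₀≡)

-- The 22 points

Canonical : Set
Canonical = Vtx ⊎ Fin 10 ⊎ Fin 6

canonicalPoint : Canonical → Point
canonicalPoint (inj₁ u)        = pV u
canonicalPoint (inj₂ (inj₁ t)) = pB (bisection t)
canonicalPoint (inj₂ (inj₂ a)) = pF (factorization a)

index : Canonical → Fin 22
index = join 6 16 ∘ map₂ (join 10 6)

split : Fin 22 → Canonical
split = map₂ (splitAt 10) ∘ splitAt 6

split∘index : ∀ c → split (index c) ≡ c
split∘index c rewrite splitAt-join 6 16 (map₂ (join 10 6) c) with c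
... | inj₁ u = refl
... | inj₂ b = cong inj₂ (splitAt-join 10 6 b)

index-injective : ∀ {c c′} → index c ≡ index c′ → c ≡ c′
index-injective {c} {c′} eq = trans (sym (split∘index c)) (trans (cong split eq) (split∘index c′))

≈P-sym : ∀ p q → p ≈P q → q ≈P p
≈P-sym (pV _) (pV _) = sym
≈P-sym (pB _) (pB _) = sym
≈P-sym (pF _) (pF _) = ≈F-sym
≈P-sym (pV _) (pB _) ()
≈P-sym (pV _) (pF _) ()
≈P-sym (pB _) (pV _) ()
≈P-sym (pB _) (pF _) ()
≈P-sym (pF _) (pV _) ()
≈P-sym (pF _) (pB _) ()

≈P-trans : ∀ p q r → p ≈P q → q ≈P r → p ≈P r
≈P-trans (pV _) (pV _) (pV _) = trans
≈P-trans (pB _) (pB _) (pB _) = trans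
≈P-trans (pF _) (pF _) (pF _) = ≈F-trans
≈P-trans (pV _) (pB _) _ ()
≈P-trans (pV _) (pF _) _ ()
≈P-trans (pB _) (pV _) _ ()
≈P-trans (pB _) (pF _) _ ()
≈P-trans (pF _) (pV _) _ ()
≈P-trans (pF _) (pB _) _ ()
≈P-trans (pV _) (pV _) (pB _) _ ()
≈P-trans (pV _) (pV _) (pF _) _ ()
≈P-trans (pB _) (pB _) (pV _) _ ()
≈P-trans (pB _) (pB _) (pF _) _ ()
≈P-trans (pF _) (pF _) (pV _) _ ()
≈P-trans (pF _) (pF _) (pB _) _ ()

point-classified : ∀ p → ValidPoint p → ∃ λ c → p ≈P canonicalPoint c
point-classified (pV u) _   = inj₁ u , refl
point-classified (pB R) bis = inj₂ (inj₁ (proj₁ (bisection-classified bis))) , proj₂ (bisection-classified bis)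
point-classified (pF f) fac = inj₂ (inj₂ (proj₁ (factorization-classified fac))) , proj₂ (factorization-classified fac)

InBlock-resp-≈F : ∀ i {f g} → f ≈F g → InBlock i (pF f) → InBlock i (pF g)
InBlock-resp-≈F allF                                  _   _        = tt
InBlock-resp-≈F (matchB _ _ _ _ _ _ _ _)              f≈g (inj₁ e) = inj₁ (≈F-trans (≈F-sym f≈g) e)
InBlock-resp-≈F (matchB _ _ _ _ _ _ _ _)              f≈g (inj₂ e) = inj₂ (≈F-trans (≈F-sym f≈g) e)
InBlock-resp-≈F (emB _ _ _ _ _ _ _ _ _ _ _ _ _)       f≈g (inj₁ e) = inj₁ (≈F-trans (≈F-sym f≈g) e)
InBlock-resp-≈F (emB _ _ _ _ _ _ _ _ _ _ _ _ _)       f≈g (inj₂ e) = inj₂ (≈F-trans (≈F-sym f≈g) e)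

InBlock-resp : ∀ i p q → p ≈P q → InBlock i p → InBlock i q
InBlock-resp i (pV _) (pV _) refl = λ p∈ → p∈
InBlock-resp i (pB _) (pB _) refl = λ p∈ → p∈
InBlock-resp i (pF _) (pF _) f≈g  = InBlock-resp-≈F i f≈g
InBlock-resp i (pV _) (pB _) ()
InBlock-resp i (pV _) (pF _) ()
InBlock-resp i (pB _) (pV _) ()
InBlock-resp i (pB _) (pF _) ()
InBlock-resp i (pF _) (pV _) ()
InBlock-resp i (pF _) (pB _) ()

-- Blocks up to SameBlock.  A block of type (ii) or (iii) is determined by its perfect matching x, as x lies
-- in exactly two 1-factorizations (factorizationPair⇔), so matchingC and edgeMatchingC do not mention them.
data Code : Set where
  edgeC           : Vtx → Vtx → Code
  verticesC       : Code
  matchingC       : Fin 15 → Code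
  factorizationsC : Code
  edgeMatchingC   : Vtx → Vtx → Fin 15 → Code

Valid : Code → Set
Valid (edgeC u v)            = u ≢ v
Valid (edgeMatchingC v v′ x) = rel (matching x) v v′
Valid _                      = ⊤

valid? : ∀ c → Dec (Valid c)
valid? (edgeC u v)            = ¬? (u ≟ v)
valid? verticesC              = yes tt
valid? (matchingC x)          = yes tt
valid? factorizationsC        = yes tt
valid? (edgeMatchingC v v′ x) = rel? (matching x) v v′

Member : Code → Canonical → Set
Member (edgeC u v)            (inj₁ y)        = y ≡ u ⊎ y ≡ v
Member (edgeC u v)            (inj₂ (inj₁ t)) = InE u v (bisection t)
Member (edgeC u v)            (inj₂ (inj₂ a)) = ⊥
Member verticesC              (inj₁ y)        = ⊤
Member verticesC              (inj₂ _)        = ⊥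
Member (matchingC x)          (inj₁ y)        = ⊥
Member (matchingC x)          (inj₂ (inj₁ t)) = InUnder (matching x) (bisection t)
Member (matchingC x)          (inj₂ (inj₂ a)) = x ∈ᶠ a
Member factorizationsC        (inj₁ _)        = ⊥
Member factorizationsC        (inj₂ (inj₁ _)) = ⊥
Member factorizationsC        (inj₂ (inj₂ _)) = ⊤
Member (edgeMatchingC v v′ x) (inj₁ y)        = y ≡ v ⊎ y ≡ v′
Member (edgeMatchingC v v′ x) (inj₂ (inj₁ t)) = ¬ InE v v′ (bisection t) × ¬ InUnder (matching x) (bisection t)
Member (edgeMatchingC v v′ x) (inj₂ (inj₂ a)) = x ∈ᶠ a

inUnder? : ∀ M R → Dec (InUnder M R)
inUnder? M R = all? λ u → all? λ v → rel? M u v →-dec ¬? (rel? R u v)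

member? : ∀ c k → Dec (Member c k)
member? (edgeC u v)            (inj₁ y)        = y ≟ u ⊎-dec y ≟ v
member? (edgeC u v)            (inj₂ (inj₁ t)) = rel? (bisection t) u v
member? (edgeC u v)            (inj₂ (inj₂ a)) = no λ ()
member? verticesC              (inj₁ y)        = yes tt
member? verticesC              (inj₂ _)        = no λ ()
member? (matchingC x)          (inj₁ y)        = no λ ()
member? (matchingC x)          (inj₂ (inj₁ t)) = inUnder? (matching x) (bisection t)
member? (matchingC x)          (inj₂ (inj₂ a)) = x ∈ᶠ? a
member? factorizationsC        (inj₁ _)        = no λ ()
member? factorizationsC        (inj₂ (inj₁ _)) = no λ ()
member? factorizationsC        (inj₂ (inj₂ _)) = yes tt
member? (edgeMatchingC v v′ x) (inj₁ y)        = y ≟ v ⊎-dec y ≟ v′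
member? (edgeMatchingC v v′ x) (inj₂ (inj₁ t)) =
  ¬? (rel? (bisection t) v v′) ×-dec ¬? (inUnder? (matching x) (bisection t))
member? (edgeMatchingC v v′ x) (inj₂ (inj₂ a)) = x ∈ᶠ? a

trace : Code → Subset 22
trace c = tabulate λ k → does (member? c (split k))

∈trace⇔Member : ∀ c k → index k ∈ trace c ⇔ Member c k
∈trace⇔Member c k = subst (λ k′ → index k ∈ trace c ⇔ Member c k′) (split∘index k)
                      (∈-tabulate-does (λ k′ → member? c (split k′)) (index k))

factorizationPair⇔ : ∀ {f g x} → IsFactorization f → IsFactorization g → ¬ f ≈F g →
                     matching x ∈ᵥ f → matching x ∈ᵥ g →
                     ∀ c → (factorization c ≈F f ⊎ factorization c ≈F g) ⇔ x ∈ᶠ c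
factorizationPair⇔ {f} {g} {x} fF gF f≉g x∈f x∈g c = mk⇔ to′ from′
  where
  a = proj₁ (factorization-classified fF)
  b = proj₁ (factorization-classified gF)
  f≈a = proj₂ (factorization-classified fF)
  g≈b = proj₂ (factorization-classified gF)
  contains : ∀ {h} d → h ≈F factorization d → matching x ∈ᵥ h → x ∈ᶠ d
  contains d h≈d x∈h = to (matching∈factorization⇔ x d) (to (h≈d (matching x)) x∈h)
  to′ : factorization c ≈F f ⊎ factorization c ≈F g → x ∈ᶠ c
  to′ (inj₁ c≈f) = contains c (≈F-sym c≈f) x∈f
  to′ (inj₂ c≈g) = contains c (≈F-sym c≈g) x∈g
  from′ : x ∈ᶠ c → factorization c ≈F f ⊎ factorization c ≈F g
  from′ x∈c = [ (λ c≡a → inj₁ (subst (λ d → factorization d ≈F f) (sym c≡a) (≈F-sym f≈a)))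
               , (λ c≡b → inj₂ (subst (λ d → factorization d ≈F g) (sym c≡b) (≈F-sym g≈b))) ]′
               (matching-inAtMostTwoFactorizations x a b c a≢b (contains a f≈a x∈f) (contains b g≈b x∈g) x∈c)
    where
    a≢b : a ≢ b
    a≢b a≡b = f≉g (≈F-trans f≈a (≈F-sym (subst (λ d → g ≈F factorization d) (sym a≡b) g≈b)))

edgeB-members : ∀ u v (u≢v : u ≢ v) k → InBlock (edgeB u v u≢v) (canonicalPoint k) ⇔ Member (edgeC u v) k
edgeB-members u v _ (inj₁ _)        = ⇔-refl
edgeB-members u v _ (inj₂ (inj₁ _)) = ⇔-refl
edgeB-members u v _ (inj₂ (inj₂ _)) = ⇔-refl

allV-members : ∀ k → InBlock allV (canonicalPoint k) ⇔ Member verticesC k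
allV-members (inj₁ _)        = ⇔-refl
allV-members (inj₂ (inj₁ _)) = ⇔-refl
allV-members (inj₂ (inj₂ _)) = ⇔-refl

allF-members : ∀ k → InBlock allF (canonicalPoint k) ⇔ Member factorizationsC k
allF-members (inj₁ _)        = ⇔-refl
allF-members (inj₂ (inj₁ _)) = ⇔-refl
allF-members (inj₂ (inj₂ _)) = ⇔-refl

matchB-members : ∀ {f g fF gF f≉g M M∈f M∈g} x → M ≡ matching x → ∀ k →
                 InBlock (matchB f g fF gF f≉g M M∈f M∈g) (canonicalPoint k) ⇔ Member (matchingC x) k
matchB-members x refl (inj₁ _)        = ⇔-refl
matchB-members x refl (inj₂ (inj₁ _)) = ⇔-refl
matchB-members {fF = fF} {gF} {f≉g} {M∈f = M∈f} {M∈g} x refl (inj₂ (inj₂ c)) = factorizationPair⇔ fF gF f≉g M∈f M∈g c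

emB-members : ∀ {v v′ v≢v′ M pm vMv′ f g fF gF f≉g M∈f M∈g} x → M ≡ matching x → ∀ k →
              InBlock (emB v v′ v≢v′ M pm vMv′ f g fF gF f≉g M∈f M∈g) (canonicalPoint k) ⇔
              Member (edgeMatchingC v v′ x) k
emB-members x refl (inj₁ _)        = ⇔-refl
emB-members x refl (inj₂ (inj₁ _)) = ⇔-refl
emB-members {fF = fF} {gF} {f≉g} {M∈f = M∈f} {M∈g} x refl (inj₂ (inj₂ c)) = factorizationPair⇔ fF gF f≉g M∈f M∈g c

module TwoFactorizations (x : Fin 15) where
  a b : Fin 6
  a = proj₁ (matching-inTwoFactorizations x)
  b = proj₁ (proj₂ (matching-inTwoFactorizations x))
  a≢b : a ≢ b
  a≢b = proj₁ (proj₂ (proj₂ (matching-inTwoFactorizations x)))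
  x∈a : x ∈ᶠ a
  x∈a = proj₁ (proj₂ (proj₂ (proj₂ (matching-inTwoFactorizations x))))
  x∈b : x ∈ᶠ b
  x∈b = proj₂ (proj₂ (proj₂ (proj₂ (matching-inTwoFactorizations x))))

block : ∀ c → Valid c → BlockIx
block (edgeC u v)            u≢v  = edgeB u v u≢v
block verticesC              _    = allV
block (matchingC x)          _    = matchB (factorization a) (factorization b)
  (factorization-isFactorization a) (factorization-isFactorization b) (factorizations-distinct a≢b)
  (matching x) (from (matching∈factorization⇔ x a) x∈a) (from (matching∈factorization⇔ x b) x∈b)
  where open TwoFactorizations x
block factorizationsC        _    = allF
block (edgeMatchingC v v′ x) vMv′ =
  emB v v′ (λ { refl → IsPerfectMatching.irreflM (matching-isPerfectMatching x) v vMv′ })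
  (matching x) (matching-isPerfectMatching x) vMv′ (factorization a) (factorization b)
  (factorization-isFactorization a) (factorization-isFactorization b) (factorizations-distinct a≢b)
  (from (matching∈factorization⇔ x a) x∈a) (from (matching∈factorization⇔ x b) x∈b)
  where open TwoFactorizations x

block-members : ∀ c (valid : Valid c) k → InBlock (block c valid) (canonicalPoint k) ⇔ Member c k
block-members (edgeC u v)            u≢v = edgeB-members u v u≢v
block-members verticesC              _   = allV-members
block-members (matchingC x)          _   = matchB-members x refl
block-members factorizationsC        _   = allF-members
block-members (edgeMatchingC v v′ x) _   = emB-members x refl

factorMatching-classified : ∀ {f M} → IsFactorization f → M ∈ᵥ f → ∃ λ x → M ≡ matching x
factorMatching-classified fF M∈f = perfectMatching-classified (All.lookup (IsFactorization.allPM fF) M∈f)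

code : BlockIx → Code
code (edgeB u v _)                      = edgeC u v
code allV                               = verticesC
code (matchB _ _ fF _ _ _ M∈f _)        = matchingC (proj₁ (factorMatching-classified fF M∈f))
code allF                               = factorizationsC
code (emB v v′ _ _ pm _ _ _ _ _ _ _ _)  = edgeMatchingC v v′ (proj₁ (perfectMatching-classified pm))

code-valid : ∀ i → Valid (code i)
code-valid (edgeB _ _ u≢v)                   = u≢v
code-valid allV                              = tt
code-valid (matchB _ _ _ _ _ _ _ _)          = tt
code-valid allF                              = tt
code-valid (emB v v′ _ _ pm vMv′ _ _ _ _ _ _ _) = subst (λ N → rel N v v′) (proj₂ (perfectMatching-classified pm)) vMv′

code-members : ∀ i k → InBlock i (canonicalPoint k) ⇔ Member (code i) k
code-members (edgeB u v u≢v)                   = edgeB-members u v u≢v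
code-members allV                              = allV-members
code-members (matchB _ _ fF _ _ _ M∈f _)       = matchB-members _ (proj₂ (factorMatching-classified fF M∈f))
code-members allF                              = allF-members
code-members (emB _ _ _ _ pm _ _ _ _ _ _ _ _)  = emB-members _ (proj₂ (perfectMatching-classified pm))

pointIndex : ∀ p → ValidPoint p → Fin 22
pointIndex p vp = index (proj₁ (point-classified p vp))

pointIndex-injective : ∀ {p q} vp vq → pointIndex p vp ≡ pointIndex q vq → p ≈P q
pointIndex-injective {p} {q} vp vq eq = ≈P-trans p _ q p≈c
  (subst (λ c → canonicalPoint c ≈P q) (sym (index-injective eq)) (≈P-sym q _ q≈c′))
  where
  p≈c = proj₂ (point-classified p vp)
  q≈c′ = proj₂ (point-classified q vq)

InBlock⇔∈trace : ∀ i d → (∀ k → InBlock i (canonicalPoint k) ⇔ Member d k) →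
                 ∀ p vp → InBlock i p ⇔ pointIndex p vp ∈ trace d
InBlock⇔∈trace i d members p vp = mk⇔
  (from (∈trace⇔Member d c) ∘ to (members c) ∘ InBlock-resp i p _ p≈c)
  (InBlock-resp i _ p (≈P-sym p _ p≈c) ∘ from (members c) ∘ to (∈trace⇔Member d c))
  where
  c = proj₁ (point-classified p vp)
  p≈c = proj₂ (point-classified p vp)

blockTrace : BlockIx → Subset 22
blockTrace = trace ∘ code

InBlock⇔∈blockTrace : ∀ i p vp → InBlock i p ⇔ pointIndex p vp ∈ blockTrace i
InBlock⇔∈blockTrace i = InBlock⇔∈trace i (code i) (code-members i)

sameBlockTrace⇒SameBlock : ∀ i j → blockTrace i ≡ blockTrace j → SameBlock i j
sameBlockTrace⇒SameBlock i j eq s vs = mk⇔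
  (from (InBlock⇔∈blockTrace j s vs) ∘ subst (pointIndex s vs ∈_) eq ∘ to (InBlock⇔∈blockTrace i s vs))
  (from (InBlock⇔∈blockTrace i s vs) ∘ subst (pointIndex s vs ∈_) (sym eq) ∘ to (InBlock⇔∈blockTrace j s vs))

-- The 77 blocks

edges : List (Vtx × Vtx)
edges = List.filter (uncurry _<?_) (List.cartesianProduct (List.allFin 6) (List.allFin 6))

blockCodes : List Code
blockCodes = verticesC ∷ factorizationsC ∷ List.map (uncurry edgeC) edges List.++ List.map matchingC (List.allFin 15)
  List.++ List.concatMap (λ x → List.map (λ (v , v′) → edgeMatchingC v v′ x) (edgesOf x)) (List.allFin 15)
  where
  edgesOf : Fin 15 → List (Vtx × Vtx)
  edgesOf x = List.filter (uncurry (rel? (matching x))) edges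

-- The normal form of List.map trace blockCodes (designBlocks-traces), written out so that the checks below
-- evaluate every block only once.
designBlocks : List (Subset 22)
designBlocks =
  (true ∷ true ∷ true ∷ true ∷ true ∷ true ∷ false ∷ false ∷ false ∷ false ∷ false ∷ false ∷ false ∷ false ∷ false ∷ false ∷ false ∷ false ∷ false ∷ false ∷ false ∷ false ∷ []) ∷
  (false ∷ false ∷ false ∷ false ∷ false ∷ false ∷ false ∷ false ∷ false ∷ false ∷ false ∷ false ∷ false ∷ false ∷ false ∷ false ∷ true ∷ true ∷ true ∷ true ∷ true ∷ true ∷ []) ∷
  (true ∷ true ∷ false ∷ false ∷ false ∷ false ∷ true ∷ true ∷ true ∷ true ∷ false ∷ false ∷ false ∷ false ∷ false ∷ false ∷ false ∷ false ∷ false ∷ false ∷ false ∷ false ∷ []) ∷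
  (true ∷ false ∷ true ∷ false ∷ false ∷ false ∷ true ∷ false ∷ false ∷ false ∷ true ∷ true ∷ true ∷ false ∷ false ∷ false ∷ false ∷ false ∷ false ∷ false ∷ false ∷ false ∷ []) ∷
  (true ∷ false ∷ false ∷ true ∷ false ∷ false ∷ false ∷ true ∷ false ∷ false ∷ true ∷ false ∷ false ∷ true ∷ true ∷ false ∷ false ∷ false ∷ false ∷ false ∷ false ∷ false ∷ []) ∷
  (true ∷ false ∷ false ∷ false ∷ true ∷ false ∷ false ∷ false ∷ true ∷ false ∷ false ∷ true ∷ false ∷ true ∷ false ∷ true ∷ false ∷ false ∷ false ∷ false ∷ false ∷ false ∷ []) ∷
  (true ∷ false ∷ false ∷ false ∷ false ∷ true ∷ false ∷ false ∷ false ∷ true ∷ false ∷ false ∷ true ∷ false ∷ true ∷ true ∷ false ∷ false ∷ false ∷ false ∷ false ∷ false ∷ []) ∷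
  (false ∷ true ∷ true ∷ false ∷ false ∷ false ∷ true ∷ false ∷ false ∷ false ∷ false ∷ false ∷ false ∷ true ∷ true ∷ true ∷ false ∷ false ∷ false ∷ false ∷ false ∷ false ∷ []) ∷
  (false ∷ true ∷ false ∷ true ∷ false ∷ false ∷ false ∷ true ∷ false ∷ false ∷ false ∷ true ∷ true ∷ false ∷ false ∷ true ∷ false ∷ false ∷ false ∷ false ∷ false ∷ false ∷ []) ∷
  (false ∷ true ∷ false ∷ false ∷ true ∷ false ∷ false ∷ false ∷ true ∷ false ∷ true ∷ false ∷ true ∷ false ∷ true ∷ false ∷ false ∷ false ∷ false ∷ false ∷ false ∷ false ∷ []) ∷
  (false ∷ true ∷ false ∷ false ∷ false ∷ true ∷ false ∷ false ∷ false ∷ true ∷ true ∷ true ∷ false ∷ true ∷ false ∷ false ∷ false ∷ false ∷ false ∷ false ∷ false ∷ false ∷ []) ∷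
  (false ∷ false ∷ true ∷ true ∷ false ∷ false ∷ false ∷ false ∷ true ∷ true ∷ true ∷ false ∷ false ∷ false ∷ false ∷ true ∷ false ∷ false ∷ false ∷ false ∷ false ∷ false ∷ []) ∷
  (false ∷ false ∷ true ∷ false ∷ true ∷ false ∷ false ∷ true ∷ false ∷ true ∷ false ∷ true ∷ false ∷ false ∷ true ∷ false ∷ false ∷ false ∷ false ∷ false ∷ false ∷ false ∷ []) ∷
  (false ∷ false ∷ true ∷ false ∷ false ∷ true ∷ false ∷ true ∷ true ∷ false ∷ false ∷ false ∷ true ∷ true ∷ false ∷ false ∷ false ∷ false ∷ false ∷ false ∷ false ∷ false ∷ []) ∷
  (false ∷ false ∷ false ∷ true ∷ true ∷ false ∷ true ∷ false ∷ false ∷ true ∷ false ∷ false ∷ true ∷ true ∷ false ∷ false ∷ false ∷ false ∷ false ∷ false ∷ false ∷ false ∷ []) ∷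
  (false ∷ false ∷ false ∷ true ∷ false ∷ true ∷ true ∷ false ∷ true ∷ false ∷ false ∷ true ∷ false ∷ false ∷ true ∷ false ∷ false ∷ false ∷ false ∷ false ∷ false ∷ false ∷ []) ∷
  (false ∷ false ∷ false ∷ false ∷ true ∷ true ∷ true ∷ true ∷ false ∷ false ∷ true ∷ false ∷ false ∷ false ∷ false ∷ true ∷ false ∷ false ∷ false ∷ false ∷ false ∷ false ∷ []) ∷
  (false ∷ false ∷ false ∷ false ∷ false ∷ false ∷ false ∷ false ∷ false ∷ false ∷ false ∷ true ∷ true ∷ true ∷ true ∷ false ∷ true ∷ true ∷ false ∷ false ∷ false ∷ false ∷ []) ∷
  (false ∷ false ∷ false ∷ false ∷ false ∷ false ∷ false ∷ false ∷ false ∷ false ∷ true ∷ false ∷ true ∷ true ∷ false ∷ true ∷ false ∷ false ∷ true ∷ true ∷ false ∷ false ∷ []) ∷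
  (false ∷ false ∷ false ∷ false ∷ false ∷ false ∷ false ∷ false ∷ false ∷ false ∷ true ∷ true ∷ false ∷ false ∷ true ∷ true ∷ false ∷ false ∷ false ∷ false ∷ true ∷ true ∷ []) ∷
  (false ∷ false ∷ false ∷ false ∷ false ∷ false ∷ false ∷ false ∷ true ∷ true ∷ false ∷ false ∷ false ∷ true ∷ true ∷ false ∷ false ∷ false ∷ true ∷ false ∷ true ∷ false ∷ []) ∷
  (false ∷ false ∷ false ∷ false ∷ false ∷ false ∷ false ∷ true ∷ false ∷ true ∷ false ∷ false ∷ false ∷ true ∷ false ∷ true ∷ true ∷ false ∷ false ∷ false ∷ false ∷ true ∷ []) ∷
  (false ∷ false ∷ false ∷ false ∷ false ∷ false ∷ false ∷ true ∷ true ∷ false ∷ false ∷ false ∷ false ∷ false ∷ true ∷ true ∷ false ∷ true ∷ false ∷ true ∷ false ∷ false ∷ []) ∷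
  (false ∷ false ∷ false ∷ false ∷ false ∷ false ∷ false ∷ false ∷ true ∷ true ∷ false ∷ true ∷ true ∷ false ∷ false ∷ false ∷ false ∷ false ∷ false ∷ true ∷ false ∷ true ∷ []) ∷
  (false ∷ false ∷ false ∷ false ∷ false ∷ false ∷ true ∷ false ∷ false ∷ true ∷ false ∷ true ∷ false ∷ false ∷ false ∷ true ∷ false ∷ true ∷ true ∷ false ∷ false ∷ false ∷ []) ∷
  (false ∷ false ∷ false ∷ false ∷ false ∷ false ∷ true ∷ false ∷ true ∷ false ∷ false ∷ false ∷ true ∷ false ∷ false ∷ true ∷ true ∷ false ∷ false ∷ false ∷ true ∷ false ∷ []) ∷
  (false ∷ false ∷ false ∷ false ∷ false ∷ false ∷ false ∷ true ∷ false ∷ true ∷ true ∷ false ∷ true ∷ false ∷ false ∷ false ∷ false ∷ true ∷ false ∷ false ∷ true ∷ false ∷ []) ∷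
  (false ∷ false ∷ false ∷ false ∷ false ∷ false ∷ true ∷ false ∷ false ∷ true ∷ true ∷ false ∷ false ∷ false ∷ true ∷ false ∷ true ∷ false ∷ false ∷ true ∷ false ∷ false ∷ []) ∷
  (false ∷ false ∷ false ∷ false ∷ false ∷ false ∷ true ∷ true ∷ false ∷ false ∷ false ∷ false ∷ true ∷ false ∷ true ∷ false ∷ false ∷ false ∷ true ∷ false ∷ false ∷ true ∷ []) ∷
  (false ∷ false ∷ false ∷ false ∷ false ∷ false ∷ false ∷ true ∷ true ∷ false ∷ true ∷ true ∷ false ∷ false ∷ false ∷ false ∷ true ∷ false ∷ true ∷ false ∷ false ∷ false ∷ []) ∷
  (false ∷ false ∷ false ∷ false ∷ false ∷ false ∷ true ∷ false ∷ true ∷ false ∷ true ∷ false ∷ false ∷ true ∷ false ∷ false ∷ false ∷ true ∷ false ∷ false ∷ false ∷ true ∷ []) ∷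
  (false ∷ false ∷ false ∷ false ∷ false ∷ false ∷ true ∷ true ∷ false ∷ false ∷ false ∷ true ∷ false ∷ true ∷ false ∷ false ∷ false ∷ false ∷ false ∷ true ∷ true ∷ false ∷ []) ∷
  (true ∷ true ∷ false ∷ false ∷ false ∷ false ∷ false ∷ false ∷ false ∷ false ∷ true ∷ false ∷ false ∷ false ∷ false ∷ true ∷ true ∷ true ∷ false ∷ false ∷ false ∷ false ∷ []) ∷
  (false ∷ false ∷ true ∷ true ∷ false ∷ false ∷ true ∷ true ∷ false ∷ false ∷ false ∷ false ∷ false ∷ false ∷ false ∷ false ∷ true ∷ true ∷ false ∷ false ∷ false ∷ false ∷ []) ∷
  (false ∷ false ∷ false ∷ false ∷ true ∷ true ∷ false ∷ false ∷ true ∷ true ∷ false ∷ false ∷ false ∷ false ∷ false ∷ false ∷ true ∷ true ∷ false ∷ false ∷ false ∷ false ∷ []) ∷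
  (true ∷ true ∷ false ∷ false ∷ false ∷ false ∷ false ∷ false ∷ false ∷ false ∷ false ∷ true ∷ false ∷ false ∷ true ∷ false ∷ false ∷ false ∷ true ∷ true ∷ false ∷ false ∷ []) ∷
  (false ∷ false ∷ true ∷ false ∷ true ∷ false ∷ true ∷ false ∷ true ∷ false ∷ false ∷ false ∷ false ∷ false ∷ false ∷ false ∷ false ∷ false ∷ true ∷ true ∷ false ∷ false ∷ []) ∷
  (false ∷ false ∷ false ∷ true ∷ false ∷ true ∷ false ∷ true ∷ false ∷ true ∷ false ∷ false ∷ false ∷ false ∷ false ∷ false ∷ false ∷ false ∷ true ∷ true ∷ false ∷ false ∷ []) ∷
  (true ∷ true ∷ false ∷ false ∷ false ∷ false ∷ false ∷ false ∷ false ∷ false ∷ false ∷ false ∷ true ∷ true ∷ false ∷ false ∷ false ∷ false ∷ false ∷ false ∷ true ∷ true ∷ []) ∷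
  (false ∷ false ∷ true ∷ false ∷ false ∷ true ∷ true ∷ false ∷ false ∷ true ∷ false ∷ false ∷ false ∷ false ∷ false ∷ false ∷ false ∷ false ∷ false ∷ false ∷ true ∷ true ∷ []) ∷
  (false ∷ false ∷ false ∷ true ∷ true ∷ false ∷ false ∷ true ∷ true ∷ false ∷ false ∷ false ∷ false ∷ false ∷ false ∷ false ∷ false ∷ false ∷ false ∷ false ∷ true ∷ true ∷ []) ∷
  (true ∷ false ∷ true ∷ false ∷ false ∷ false ∷ false ∷ true ∷ false ∷ false ∷ false ∷ false ∷ false ∷ false ∷ false ∷ true ∷ false ∷ false ∷ true ∷ false ∷ true ∷ false ∷ []) ∷
  (false ∷ true ∷ false ∷ true ∷ false ∷ false ∷ true ∷ false ∷ false ∷ false ∷ true ∷ false ∷ false ∷ false ∷ false ∷ false ∷ false ∷ false ∷ true ∷ false ∷ true ∷ false ∷ []) ∷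
  (false ∷ false ∷ false ∷ false ∷ true ∷ true ∷ false ∷ false ∷ false ∷ false ∷ false ∷ true ∷ true ∷ false ∷ false ∷ false ∷ false ∷ false ∷ true ∷ false ∷ true ∷ false ∷ []) ∷
  (true ∷ false ∷ true ∷ false ∷ false ∷ false ∷ false ∷ false ∷ true ∷ false ∷ false ∷ false ∷ false ∷ false ∷ true ∷ false ∷ true ∷ false ∷ false ∷ false ∷ false ∷ true ∷ []) ∷
  (false ∷ true ∷ false ∷ false ∷ true ∷ false ∷ true ∷ false ∷ false ∷ false ∷ false ∷ true ∷ false ∷ false ∷ false ∷ false ∷ true ∷ false ∷ false ∷ false ∷ false ∷ true ∷ []) ∷
  (false ∷ false ∷ false ∷ true ∷ false ∷ true ∷ false ∷ false ∷ false ∷ false ∷ true ∷ false ∷ true ∷ false ∷ false ∷ false ∷ true ∷ false ∷ false ∷ false ∷ false ∷ true ∷ []) ∷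
  (true ∷ false ∷ true ∷ false ∷ false ∷ false ∷ false ∷ false ∷ false ∷ true ∷ false ∷ false ∷ false ∷ true ∷ false ∷ false ∷ false ∷ true ∷ false ∷ true ∷ false ∷ false ∷ []) ∷
  (false ∷ true ∷ false ∷ false ∷ false ∷ true ∷ true ∷ false ∷ false ∷ false ∷ false ∷ false ∷ true ∷ false ∷ false ∷ false ∷ false ∷ true ∷ false ∷ true ∷ false ∷ false ∷ []) ∷
  (false ∷ false ∷ false ∷ true ∷ true ∷ false ∷ false ∷ false ∷ false ∷ false ∷ true ∷ true ∷ false ∷ false ∷ false ∷ false ∷ false ∷ true ∷ false ∷ true ∷ false ∷ false ∷ []) ∷
  (true ∷ false ∷ false ∷ true ∷ false ∷ false ∷ true ∷ false ∷ false ∷ false ∷ false ∷ false ∷ false ∷ false ∷ false ∷ true ∷ false ∷ false ∷ false ∷ true ∷ false ∷ true ∷ []) ∷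
  (false ∷ true ∷ true ∷ false ∷ false ∷ false ∷ false ∷ true ∷ false ∷ false ∷ true ∷ false ∷ false ∷ false ∷ false ∷ false ∷ false ∷ false ∷ false ∷ true ∷ false ∷ true ∷ []) ∷
  (false ∷ false ∷ false ∷ false ∷ true ∷ true ∷ false ∷ false ∷ false ∷ false ∷ false ∷ false ∷ false ∷ true ∷ true ∷ false ∷ false ∷ false ∷ false ∷ true ∷ false ∷ true ∷ []) ∷
  (true ∷ false ∷ false ∷ true ∷ false ∷ false ∷ false ∷ false ∷ true ∷ false ∷ false ∷ false ∷ true ∷ false ∷ false ∷ false ∷ false ∷ true ∷ true ∷ false ∷ false ∷ false ∷ []) ∷
  (false ∷ true ∷ false ∷ false ∷ true ∷ false ∷ false ∷ true ∷ false ∷ false ∷ false ∷ false ∷ false ∷ true ∷ false ∷ false ∷ false ∷ true ∷ true ∷ false ∷ false ∷ false ∷ []) ∷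
  (false ∷ false ∷ true ∷ false ∷ false ∷ true ∷ false ∷ false ∷ false ∷ false ∷ true ∷ false ∷ false ∷ false ∷ true ∷ false ∷ false ∷ true ∷ true ∷ false ∷ false ∷ false ∷ []) ∷
  (true ∷ false ∷ false ∷ true ∷ false ∷ false ∷ false ∷ false ∷ false ∷ true ∷ false ∷ true ∷ false ∷ false ∷ false ∷ false ∷ true ∷ false ∷ false ∷ false ∷ true ∷ false ∷ []) ∷
  (false ∷ true ∷ false ∷ false ∷ false ∷ true ∷ false ∷ true ∷ false ∷ false ∷ false ∷ false ∷ false ∷ false ∷ true ∷ false ∷ true ∷ false ∷ false ∷ false ∷ true ∷ false ∷ []) ∷
  (false ∷ false ∷ true ∷ false ∷ true ∷ false ∷ false ∷ false ∷ false ∷ false ∷ true ∷ false ∷ false ∷ true ∷ false ∷ false ∷ true ∷ false ∷ false ∷ false ∷ true ∷ false ∷ []) ∷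
  (true ∷ false ∷ false ∷ false ∷ true ∷ false ∷ true ∷ false ∷ false ∷ false ∷ false ∷ false ∷ false ∷ false ∷ true ∷ false ∷ false ∷ true ∷ false ∷ false ∷ true ∷ false ∷ []) ∷
  (false ∷ true ∷ true ∷ false ∷ false ∷ false ∷ false ∷ false ∷ true ∷ false ∷ false ∷ true ∷ false ∷ false ∷ false ∷ false ∷ false ∷ true ∷ false ∷ false ∷ true ∷ false ∷ []) ∷
  (false ∷ false ∷ false ∷ true ∷ false ∷ true ∷ false ∷ false ∷ false ∷ false ∷ false ∷ false ∷ false ∷ true ∷ false ∷ true ∷ false ∷ true ∷ false ∷ false ∷ true ∷ false ∷ []) ∷
  (true ∷ false ∷ false ∷ false ∷ true ∷ false ∷ false ∷ true ∷ false ∷ false ∷ false ∷ false ∷ true ∷ false ∷ false ∷ false ∷ true ∷ false ∷ false ∷ true ∷ false ∷ false ∷ []) ∷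
  (false ∷ true ∷ false ∷ true ∷ false ∷ false ∷ false ∷ false ∷ true ∷ false ∷ false ∷ false ∷ false ∷ true ∷ false ∷ false ∷ true ∷ false ∷ false ∷ true ∷ false ∷ false ∷ []) ∷
  (false ∷ false ∷ true ∷ false ∷ false ∷ true ∷ false ∷ false ∷ false ∷ false ∷ false ∷ true ∷ false ∷ false ∷ false ∷ true ∷ true ∷ false ∷ false ∷ true ∷ false ∷ false ∷ []) ∷
  (true ∷ false ∷ false ∷ false ∷ true ∷ false ∷ false ∷ false ∷ false ∷ true ∷ true ∷ false ∷ false ∷ false ∷ false ∷ false ∷ false ∷ false ∷ true ∷ false ∷ false ∷ true ∷ []) ∷
  (false ∷ true ∷ false ∷ false ∷ false ∷ true ∷ false ∷ false ∷ true ∷ false ∷ false ∷ false ∷ false ∷ false ∷ false ∷ true ∷ false ∷ false ∷ true ∷ false ∷ false ∷ true ∷ []) ∷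
  (false ∷ false ∷ true ∷ true ∷ false ∷ false ∷ false ∷ false ∷ false ∷ false ∷ false ∷ true ∷ false ∷ true ∷ false ∷ false ∷ false ∷ false ∷ true ∷ false ∷ false ∷ true ∷ []) ∷
  (true ∷ false ∷ false ∷ false ∷ false ∷ true ∷ true ∷ false ∷ false ∷ false ∷ false ∷ false ∷ false ∷ true ∷ false ∷ false ∷ true ∷ false ∷ true ∷ false ∷ false ∷ false ∷ []) ∷
  (false ∷ true ∷ true ∷ false ∷ false ∷ false ∷ false ∷ false ∷ false ∷ true ∷ false ∷ false ∷ true ∷ false ∷ false ∷ false ∷ true ∷ false ∷ true ∷ false ∷ false ∷ false ∷ []) ∷
  (false ∷ false ∷ false ∷ true ∷ true ∷ false ∷ false ∷ false ∷ false ∷ false ∷ false ∷ false ∷ false ∷ false ∷ true ∷ true ∷ true ∷ false ∷ true ∷ false ∷ false ∷ false ∷ []) ∷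
  (true ∷ false ∷ false ∷ false ∷ false ∷ true ∷ false ∷ true ∷ false ∷ false ∷ false ∷ true ∷ false ∷ false ∷ false ∷ false ∷ false ∷ true ∷ false ∷ false ∷ false ∷ true ∷ []) ∷
  (false ∷ true ∷ false ∷ true ∷ false ∷ false ∷ false ∷ false ∷ false ∷ true ∷ false ∷ false ∷ false ∷ false ∷ true ∷ false ∷ false ∷ true ∷ false ∷ false ∷ false ∷ true ∷ []) ∷
  (false ∷ false ∷ true ∷ false ∷ true ∷ false ∷ false ∷ false ∷ false ∷ false ∷ false ∷ false ∷ true ∷ false ∷ false ∷ true ∷ false ∷ true ∷ false ∷ false ∷ false ∷ true ∷ []) ∷
  (true ∷ false ∷ false ∷ false ∷ false ∷ true ∷ false ∷ false ∷ true ∷ false ∷ true ∷ false ∷ false ∷ false ∷ false ∷ false ∷ false ∷ false ∷ false ∷ true ∷ true ∷ false ∷ []) ∷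
  (false ∷ true ∷ false ∷ false ∷ true ∷ false ∷ false ∷ false ∷ false ∷ true ∷ false ∷ false ∷ false ∷ false ∷ false ∷ true ∷ false ∷ false ∷ false ∷ true ∷ true ∷ false ∷ []) ∷
  (false ∷ false ∷ true ∷ true ∷ false ∷ false ∷ false ∷ false ∷ false ∷ false ∷ false ∷ false ∷ true ∷ false ∷ true ∷ false ∷ false ∷ false ∷ false ∷ true ∷ true ∷ false ∷ []) ∷ []

abstract
  designBlocks-traces : designBlocks ≡ List.map trace blockCodes
  designBlocks-traces = refl

private
  _∈ₗ?_ = ListDecMembership._∈?_ (Vecₚ.≡-dec {n = 22} Boolₚ._≟_)

abstract
  blockCodes-valid : ListAll.All Valid blockCodes
  blockCodes-valid = toWitness {a? = ListAll.all? valid? blockCodes} _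

  validCode-traceListed : ∀ c → Valid c → trace c ∈ₗ designBlocks
  validCode-traceListed (edgeC u v) = toWitness
    {a? = all? λ u → all? λ v → ¬? (u ≟ v) →-dec trace (edgeC u v) ∈ₗ? designBlocks} _ u v
  validCode-traceListed verticesC _ = toWitness {a? = trace verticesC ∈ₗ? designBlocks} _
  validCode-traceListed (matchingC x) _ = toWitness {a? = all? λ x → trace (matchingC x) ∈ₗ? designBlocks} _ x
  validCode-traceListed factorizationsC _ = toWitness {a? = trace factorizationsC ∈ₗ? designBlocks} _
  validCode-traceListed (edgeMatchingC v v′ x) = toWitness
    {a? = all? λ v → all? λ v′ → all? λ x →
          rel? (matching x) v v′ →-dec trace (edgeMatchingC v v′ x) ∈ₗ? designBlocks} _ v v′ x

  designBlocks-meetInAtMostTwo :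
    ListAll.All (λ w → ListAll.All (λ w′ → w ≡ w′ ⊎ ∣ w ∩ w′ ∣ ≤ 2) designBlocks) designBlocks
  designBlocks-meetInAtMostTwo = toWitness
    {a? = ListAll.all? (λ w → ListAll.all? (λ w′ → Vecₚ.≡-dec Boolₚ._≟_ w w′ ⊎-dec ∣ w ∩ w′ ∣ ≤? 2) designBlocks)
                       designBlocks} _

  designBlocks-coverIncreasingTriples : ∀ k₁ k₂ k₃ → k₁ < k₂ → k₂ < k₃ →
                                        ListAny.Any (λ w → k₁ ∈ w × k₂ ∈ w × k₃ ∈ w) designBlocks
  designBlocks-coverIncreasingTriples = toWitness
    {a? = all? λ k₁ → all? λ k₂ → all? λ k₃ → k₁ <? k₂ →-dec k₂ <? k₃ →-dec
          ListAny.any? (λ w → k₁ ∈? w ×-dec k₂ ∈? w ×-dec k₃ ∈? w) designBlocks} _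

blockTrace-listed : ∀ i → blockTrace i ∈ₗ designBlocks
blockTrace-listed i = validCode-traceListed (code i) (code-valid i)

designBlock-realized : ∀ {w} → w ∈ₗ designBlocks → ∃ λ i → ∀ p vp → InBlock i p ⇔ pointIndex p vp ∈ w
designBlock-realized {w} w∈ = block d valid , λ p vp →
  subst (λ w′ → InBlock (block d valid) p ⇔ pointIndex p vp ∈ w′) (sym w≡trace)
        (InBlock⇔∈trace (block d valid) d (block-members d valid) p vp)
  where
  coded = ∈-map⁻ trace (subst (w ∈ₗ_) designBlocks-traces w∈)
  d = proj₁ coded
  valid = ListAll.lookup blockCodes-valid (proj₁ (proj₂ coded))
  w≡trace = proj₂ (proj₂ coded)

designBlocks-threeCommonPoints⇒≡ : ∀ {w w′ k₁ k₂ k₃} → w ∈ₗ designBlocks → w′ ∈ₗ designBlocks →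
  k₁ ≢ k₂ → k₁ ≢ k₃ → k₂ ≢ k₃ → k₁ ∈ w → k₂ ∈ w → k₃ ∈ w → k₁ ∈ w′ → k₂ ∈ w′ → k₃ ∈ w′ → w ≡ w′
designBlocks-threeCommonPoints⇒≡ w∈ w′∈ k₁≢k₂ k₁≢k₃ k₂≢k₃ k₁∈w k₂∈w k₃∈w k₁∈w′ k₂∈w′ k₃∈w′ =
  [ (λ w≡w′ → w≡w′) , (λ ∣∩∣≤2 → contradiction 3≤∣∩∣ (ℕₚ.≤⇒≯ ∣∩∣≤2)) ]′
  (ListAll.lookup (ListAll.lookup designBlocks-meetInAtMostTwo w∈) w′∈)
  where
  3≤∣∩∣ = three-elements⇒3≤∣p∣ (x∈p∩q⁺ (k₁∈w , k₁∈w′)) (x∈p∩q⁺ (k₂∈w , k₂∈w′)) (x∈p∩q⁺ (k₃∈w , k₃∈w′))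
                                k₁≢k₂ k₁≢k₃ k₂≢k₃

designBlocks-coverTriples : ∀ k₁ k₂ k₃ → k₁ ≢ k₂ → k₁ ≢ k₃ → k₂ ≢ k₃ →
                            ListAny.Any (λ w → k₁ ∈ w × k₂ ∈ w × k₃ ∈ w) designBlocks
designBlocks-coverTriples = increasing⇒distinct
  (ListAny.map λ (k₁∈ , k₂∈ , k₃∈) → k₂∈ , k₁∈ , k₃∈)
  (ListAny.map λ (k₁∈ , k₂∈ , k₃∈) → k₁∈ , k₃∈ , k₂∈)
  designBlocks-coverIncreasingTriples

mainTheorem1 : Is3Design1
mainTheorem1 p q r vp vq vr p≉q p≉r q≉r = existence , uniqueness
  where
  kp≢kq = p≉q ∘ pointIndex-injective vp vq
  kp≢kr = p≉r ∘ pointIndex-injective vp vr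
  kq≢kr = q≉r ∘ pointIndex-injective vq vr

  existence : ∃ λ i → InBlock i p × InBlock i q × InBlock i r
  existence =
    let w , w∈ , kp∈ , kq∈ , kr∈ = find (designBlocks-coverTriples _ _ _ kp≢kq kp≢kr kq≢kr)
        i , i⇔ = designBlock-realized w∈
    in i , from (i⇔ p vp) kp∈ , from (i⇔ q vq) kq∈ , from (i⇔ r vr) kr∈

  uniqueness : ∀ i j → InBlock i p → InBlock i q → InBlock i r → InBlock j p → InBlock j q → InBlock j r →
               SameBlock i j
  uniqueness i j ip iq ir jp jq jr = sameBlockTrace⇒SameBlock i j
    (designBlocks-threeCommonPoints⇒≡ (blockTrace-listed i) (blockTrace-listed j) kp≢kq kp≢kr kq≢kr
      (∈trace i p vp ip) (∈trace i q vq iq) (∈trace i r vr ir)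
      (∈trace j p vp jp) (∈trace j q vq jq) (∈trace j r vr jr))
    where
    ∈trace : ∀ i s vs → InBlock i s → pointIndex s vs ∈ blockTrace i
    ∈trace i s vs = to (InBlock⇔∈blockTrace i s vs)
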